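{- For $k\ge 4$, the fan $F_k$ has $r$-critical pebbling number $c_r(F_k)=k$.
   Context: The fan $F_k$ is the path $P_k$ on $k$ vertices together with an additional vertex $x$ adjacent to every vertex of the path. A pebbling distribution assigns to each vertex a non-negative integer number of pebbles. A pebbling step $[a,b]$, for adjacent $a,b$, removes two pebbles from $a$ and adds one to $b$. A rooted distribution with root $r$ is $r$-solvable if some sequence of pebbling steps ends with at least one pebble on $r$; it is $r$-critical if it is $r$-solvable but removing any single pebble makes it not $r$-solvable. $c_r(G)$ is the largest number of pebbles in an $r$-critical rooted distribution on $G$, over all roots $r$. -}

module Defs where

open import Data.Nat using (ℕ; zero; suc; _+_; _∸_; _≤_)
open import Data.Fin using (Fin; zero; suc; toℕ; _≟_)
open import Data.List using (List; map; allFin)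
open import Data.Nat.ListAction using (sum)
open import Data.Product using (Σ; ∃; _×_; _,_)
open import Relation.Nullary using (¬_; yes; no)
open import Relation.Binary.PropositionalEquality using (_≡_)
open import Relation.Binary.Construct.Closure.ReflexiveTransitive using (Star)

record Graph : Set₁ where
  field
    size : ℕ
    Adj  : Fin size → Fin size → Set
open Graph public

Distribution : ℕ → Set
Distribution n = Fin n → ℕ

ind : {n : ℕ} → Fin n → Fin n → ℕ → ℕ
ind u v c with u ≟ v
... | yes _ = c
... | no  _ = 0

total : {n : ℕ} → Distribution n → ℕ
total {n} D = sum (map D (allFin n))

-- pebbling step [a,b]: remove two pebbles from a, add one to b
-- (D' v + 2[v=a] = D v + [v=b] for all v, and D a ≥ 2)
data Step (G : Graph) : Distribution (size G) → Distribution (size G) → Set where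
  step : (a b : Fin (size G)) → Adj G a b →
         (D D' : Distribution (size G)) → 2 ≤ D a →
         (∀ v → D' v + ind v a 2 ≡ D v + ind v b 1) →
         Step G D D'

Reachable : (G : Graph) → Distribution (size G) → Distribution (size G) → Set
Reachable G = Star (Step G)

Solvable : (G : Graph) → Fin (size G) → Distribution (size G) → Set
Solvable G r D = Σ (Distribution (size G)) λ D' → Reachable G D D' × (1 ≤ D' r)

removeOne : {n : ℕ} → Distribution n → Fin n → Distribution n
removeOne D v u with u ≟ v
... | yes _ = D u ∸ 1
... | no  _ = D u

Critical : (G : Graph) → Fin (size G) → Distribution (size G) → Set
Critical G r D = Solvable G r D × (∀ v → 1 ≤ D v → ¬ Solvable G r (removeOne D v))

-- c_r(G) = m : m is the largest number of pebbles in an r-critical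
-- distribution, over all roots r.
IsCriticalPebblingNumber : Graph → ℕ → Set
IsCriticalPebblingNumber G m =
  (Σ (Fin (size G)) λ r → Σ (Distribution (size G)) λ D → Critical G r D × total D ≡ m)
  × (∀ r D → Critical G r D → total D ≤ m)

-- Fan F_k: vertex zero is the hub x; suc i (i : Fin k) is the i-th path vertex.
data FanAdj (k : ℕ) : Fin (suc k) → Fin (suc k) → Set where
  hub-path : (i : Fin k) → FanAdj k zero (suc i)
  path-hub : (i : Fin k) → FanAdj k (suc i) zero
  path-fwd : (i j : Fin k) → suc (toℕ i) ≡ toℕ j → FanAdj k (suc i) (suc j)
  path-bwd : (i j : Fin k) → toℕ i ≡ suc (toℕ j) → FanAdj k (suc i) (suc j)

Fan : ℕ → Graph
Fan k = record { size = suc k ; Adj = FanAdj k }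

-- Root the fan at an end vertex of the path and put one pebble on every other path
-- vertex and a second one on the far end: k pebbles, and rolling the pair along the path solves the
-- root. After removing any pebble the configuration is hopeless: either no vertex holds two pebbles,
-- or the hub is empty and the only pair lies beyond an empty path vertex. A pair can only move to a
-- neighbour; onto an empty vertex this leaves no pair at all, onto a vertex with one pebble it shifts
-- the pair, which therefore never crosses the gap towards the root.
--
-- If every distribution dominating a threshold T is solvable and a critical D
-- dominates T, then D ≤ T, since a pebble above T could be removed. This bounds the total by 1 if
-- the root holds a pebble. Otherwise some vertex carries a pair, and the thresholds "a pair next to
-- the root", "a pebble on the hub and a pair", "four on a path vertex" and "two pairs" bound the
-- total by 4 ≤ k. What remains is a path root, an empty hub and a single pile of at most three
-- pebbles, every other vertex holding at most one. Then the root and the hub are empty, and so is a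
-- third vertex if the pile has three pebbles (otherwise one of them could be removed and the rest
-- rolled to the root), leaving at most k pebbles.

module Submission where

open import Defs
open import Data.Nat using (ℕ; zero; suc; _+_; _*_; _∸_; _≤_; _<_; z≤n; s≤s; _≤?_; _≟_)
open import Data.Nat.Properties
open import Algebra.Properties.CommutativeSemigroup +-commutativeSemigroup using () renaming (interchange to +-interchange)
open import Data.Fin using (Fin; zero; suc; toℕ; fromℕ; fromℕ<) renaming (_≟_ to _≟ᶠ_)
import Data.Fin.Properties as Fin
open import Data.List using (List; []; _∷_; length)
open import Data.List.Properties using (map-tabulate)
open import Data.List.Relation.Unary.All as All using (All; []; _∷_)
open import Data.List.Relation.Unary.AllPairs using (AllPairs; []; _∷_)
open import Data.Nat.ListAction using (sum)
open import Data.Product using (∃; _×_; _,_; proj₁; proj₂)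
open import Data.Sum using (_⊎_; inj₁; inj₂)
open import Function using (_∘_; id)
open import Relation.Nullary using (¬_; Dec; yes; no; contradiction; ¬?)
open import Relation.Nullary.Decidable using (_×-dec_)
open import Relation.Binary using (tri<; tri≈; tri>)
open import Relation.Binary.PropositionalEquality
open import Relation.Binary.Construct.Closure.ReflexiveTransitive using (ε; _◅_)

private
  variable
    n : ℕ

-- Totals of distributions

ind-≡ : (v : Fin n) (c : ℕ) → ind v v c ≡ c
ind-≡ v c with v ≟ᶠ v
... | yes _ = refl
... | no v≢v = contradiction refl v≢v

ind-≢ : {v u : Fin n} (c : ℕ) → v ≢ u → ind v u c ≡ 0
ind-≢ {v = v} {u} c v≢u with v ≟ᶠ u
... | yes v≡u = contradiction v≡u v≢u
... | no _ = refl

ind-suc : (v u : Fin n) (c : ℕ) → ind (suc v) (suc u) c ≡ ind v u c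
ind-suc v u c = by-cases (v ≟ᶠ u)
  where
  by-cases : Dec (v ≡ u) → ind (suc v) (suc u) c ≡ ind v u c
  by-cases (yes refl) = trans (ind-≡ (suc v) c) (sym (ind-≡ v c))
  by-cases (no v≢u)   = trans (ind-≢ c (v≢u ∘ Fin.suc-injective)) (sym (ind-≢ c v≢u))

_≤ᴰ_ : Distribution n → Distribution n → Set
D ≤ᴰ E = ∀ v → D v ≤ E v

addPebbles : Distribution n → Fin n → ℕ → Distribution n
addPebbles D u c v = D v + ind v u c

pebbles : Fin n → ℕ → Distribution n
pebbles u c v = ind v u c

total-suc : (D : Distribution (suc n)) → total D ≡ D zero + total (D ∘ suc)
total-suc {n} D = cong (λ xs → D zero + sum xs)
  (trans (map-tabulate suc D) (sym (map-tabulate id (D ∘ suc))))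

total-mono : {D E : Distribution n} → D ≤ᴰ E → total D ≤ total E
total-mono {zero} D≤E = z≤n
total-mono {suc n} {D} {E} D≤E = begin
  total D                  ≡⟨ total-suc D ⟩
  D zero + total (D ∘ suc) ≤⟨ +-mono-≤ (D≤E zero) (total-mono (D≤E ∘ suc)) ⟩
  E zero + total (E ∘ suc) ≡⟨ total-suc E ⟨
  total E                  ∎
  where open ≤-Reasoning

total-cong : {D E : Distribution n} → (∀ v → D v ≡ E v) → total D ≡ total E
total-cong D≗E = ≤-antisym (total-mono (≤-reflexive ∘ D≗E)) (total-mono (≤-reflexive ∘ sym ∘ D≗E))

total-+ : (D E : Distribution n) → total (λ v → D v + E v) ≡ total D + total E
total-+ {zero} D E = refl
total-+ {suc n} D E = begin
  total (λ v → D v + E v)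
    ≡⟨ total-suc (λ v → D v + E v) ⟩
  (D zero + E zero) + total (λ v → D (suc v) + E (suc v))
    ≡⟨ cong (D zero + E zero +_) (total-+ (D ∘ suc) (E ∘ suc)) ⟩
  (D zero + E zero) + (total (D ∘ suc) + total (E ∘ suc))
    ≡⟨ +-interchange (D zero) (E zero) _ _ ⟩
  (D zero + total (D ∘ suc)) + (E zero + total (E ∘ suc))
    ≡⟨ cong₂ _+_ (total-suc D) (total-suc E) ⟨
  total D + total E
    ∎
  where open ≡-Reasoning

total-const : (c : ℕ) → total {n} (λ _ → c) ≡ n * c
total-const {zero} c = refl
total-const {suc n} c = trans (total-suc {n} (λ _ → c)) (cong (c +_) (total-const {n} c))

total-pebbles : (u : Fin n) (c : ℕ) → total (pebbles u c) ≡ c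
total-pebbles {suc n} zero c = begin
  total (pebbles {suc n} zero c)  ≡⟨ total-suc {n} (pebbles zero c) ⟩
  c + total {n} (λ _ → 0)         ≡⟨ cong (c +_) (trans (total-const {n} 0) (*-zeroʳ n)) ⟩
  c + 0                           ≡⟨ +-identityʳ c ⟩
  c                               ∎
  where open ≡-Reasoning
total-pebbles {suc n} (suc u) c = begin
  total (pebbles (suc u) c)                  ≡⟨ total-suc {n} (pebbles (suc u) c) ⟩
  total (λ v → ind (suc v) (suc u) c)        ≡⟨ total-cong (λ v → ind-suc v u c) ⟩
  total (pebbles u c)                        ≡⟨ total-pebbles u c ⟩
  c                                          ∎
  where open ≡-Reasoning

total-addPebbles : (D : Distribution n) (u : Fin n) (c : ℕ) → total (addPebbles D u c) ≡ total D + c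
total-addPebbles D u c = trans (total-+ D (pebbles u c)) (cong (total D +_) (total-pebbles u c))

pebbles-≤ᴰ : {E : Distribution n} {u : Fin n} {c : ℕ} → c ≤ E u → pebbles u c ≤ᴰ E
pebbles-≤ᴰ {u = u} c≤Eu v with v ≟ᶠ u
... | yes refl = c≤Eu
... | no _ = z≤n

total-≤-sparse : {D : Distribution n} (a : Fin n) (e : ℕ) (holes : List (Fin n)) → AllPairs _≢_ holes →
                 All (λ z → z ≢ a × D z ≡ 0) holes → (∀ v → v ≢ a → D v ≤ 1) → D a ≤ suc e →
                 total D + length holes ≤ n + e
total-≤-sparse {n} {D} a e [] _ _ D≤1 Da≤1+e = begin
  total D + 0                           ≡⟨ +-identityʳ (total D) ⟩
  total D                               ≤⟨ total-mono D≤bound ⟩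
  total (addPebbles (λ _ → 1) a e)      ≡⟨ total-addPebbles (λ _ → 1) a e ⟩
  total {n} (λ _ → 1) + e               ≡⟨ cong (_+ e) (trans (total-const {n} 1) (*-identityʳ n)) ⟩
  n + e                                 ∎
  where
  open ≤-Reasoning
  D≤bound : D ≤ᴰ addPebbles (λ _ → 1) a e
  D≤bound v with v ≟ᶠ a
  ... | yes refl = Da≤1+e
  ... | no v≢a = subst (D v ≤_) (sym (+-identityʳ 1)) (D≤1 v v≢a)
total-≤-sparse {n} {D} a e (z ∷ holes) (z∉holes ∷ distinct) ((z≢a , Dz≡0) ∷ vanish) D≤1 Da≤1+e = begin
  total D + suc (length holes)          ≡⟨ +-suc (total D) _ ⟩
  suc (total D) + length holes          ≡⟨ cong (_+ length holes) (+-comm 1 (total D)) ⟩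
  total D + 1 + length holes            ≡⟨ cong (_+ length holes) (total-addPebbles D z 1) ⟨
  total D' + length holes               ≤⟨ total-≤-sparse a e holes distinct vanish' D'≤1 D'a≤1+e ⟩
  n + e                                 ∎
  where
  open ≤-Reasoning
  D' : Distribution n
  D' = addPebbles D z 1
  unchanged : ∀ {v} → v ≢ z → D' v ≡ D v
  unchanged v≢z = trans (cong (_ +_) (ind-≢ 1 v≢z)) (+-identityʳ _)
  vanish' : All (λ w → w ≢ a × D' w ≡ 0) holes
  vanish' = All.zipWith (λ (z≢w , (w≢a , Dw≡0)) → w≢a , trans (unchanged (z≢w ∘ sym)) Dw≡0)
                        (z∉holes , vanish)
  D'≤1 : ∀ v → v ≢ a → D' v ≤ 1
  D'≤1 v v≢a with v ≟ᶠ z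
  ... | yes refl = ≤-reflexive (cong (_+ 1) Dz≡0)
  ... | no _ = subst (_≤ 1) (sym (+-identityʳ (D v))) (D≤1 v v≢a)
  D'a≤1+e : D' a ≤ suc e
  D'a≤1+e = subst (_≤ suc e) (sym (unchanged (z≢a ∘ sym))) Da≤1+e

m+1+e≤1+n+e⇒m≤n : ∀ {m n e} → m + suc e ≤ suc n + e → m ≤ n
m+1+e≤1+n+e⇒m≤n {m} {n} {e} le = +-cancelʳ-≤ (suc e) m n (subst (m + suc e ≤_) (sym (+-suc n e)) le)

-- Pebbling moves

-- Because of truncated subtraction this is the outcome of the step [a,b] only when 2 ≤ D a.
move : Distribution n → Fin n → Fin n → Distribution n
move D a b v = D v ∸ ind v a 2 + ind v b 1

module _ {D : Distribution n} {a b : Fin n} where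

  move-source : a ≢ b → move D a b a ≡ D a ∸ 2
  move-source a≢b = trans (cong₂ (λ x y → D a ∸ x + y) (ind-≡ a 2) (ind-≢ 1 a≢b)) (+-identityʳ _)

  move-target : b ≢ a → move D a b b ≡ suc (D b)
  move-target b≢a = trans (cong₂ (λ x y → D b ∸ x + y) (ind-≢ 2 b≢a) (ind-≡ b 1)) (+-comm (D b) 1)

  move-other : {v : Fin n} → v ≢ a → v ≢ b → move D a b v ≡ D v
  move-other v≢a v≢b = trans (cong₂ (λ x y → D _ ∸ x + y) (ind-≢ 2 v≢a) (ind-≢ 1 v≢b)) (+-identityʳ _)

  move-≥ : {v : Fin n} → v ≢ a → D v ≤ move D a b v
  move-≥ {v} v≢a = subst (λ x → D v ≤ D v ∸ x + ind v b 1) (sym (ind-≢ 2 v≢a)) (m≤m+n (D v) _)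

  move-balance : 2 ≤ D a → ∀ v → move D a b v + ind v a 2 ≡ D v + ind v b 1
  move-balance 2≤Da v = begin
    D v ∸ ind v a 2 + ind v b 1 + ind v a 2  ≡⟨ cong (_+ ind v a 2) (+-∸-comm (ind v b 1) removable) ⟨
    D v + ind v b 1 ∸ ind v a 2 + ind v a 2  ≡⟨ m∸n+n≡m (≤-trans removable (m≤m+n (D v) _)) ⟩
    D v + ind v b 1                          ∎
    where
    open ≡-Reasoning
    removable : ind v a 2 ≤ D v
    removable = pebbles-≤ᴰ 2≤Da v

  step-moves : {D' : Distribution n} → (∀ v → D' v + ind v a 2 ≡ D v + ind v b 1) → 2 ≤ D a →
               ∀ v → D' v ≡ move D a b v
  step-moves balance 2≤Da v = +-cancelʳ-≡ (ind v a 2) _ _ (trans (balance v) (sym (move-balance 2≤Da v)))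

move-≤-1-off-target : {D : Distribution n} {a b : Fin n} → a ≢ b → D a ≤ 3 →
                      (∀ v → v ≢ a → D v ≤ 1) → ∀ v → v ≢ b → move D a b v ≤ 1
move-≤-1-off-target {D = D} {a} {b} a≢b Da≤3 others-≤-1 v v≢b = by-cases (v ≟ᶠ a)
  where
  by-cases : Dec (v ≡ a) → move D a b v ≤ 1
  by-cases (yes refl) = subst (_≤ 1) (sym (move-source {D = D} a≢b)) (∸-monoˡ-≤ 2 Da≤3)
  by-cases (no v≢a) = subst (_≤ 1) (sym (move-other {D = D} v≢a v≢b)) (others-≤-1 v v≢a)

Stuck : Distribution n → Set
Stuck D = ∀ v → D v ≤ 1

stuck-after-move-to-empty : {D : Distribution n} {a b : Fin n} → a ≢ b → D a ≤ 3 →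
                            (∀ v → v ≢ a → D v ≤ 1) → D b ≡ 0 → Stuck (move D a b)
stuck-after-move-to-empty {D = D} {a} {b} a≢b Da≤3 others-≤-1 Db≡0 v = by-cases (v ≟ᶠ b)
  where
  by-cases : Dec (v ≡ b) → move D a b v ≤ 1
  by-cases (yes refl) = ≤-reflexive (trans (move-target {D = D} (a≢b ∘ sym)) (cong suc Db≡0))
  by-cases (no v≢b) = move-≤-1-off-target a≢b Da≤3 others-≤-1 v v≢b

module _ (G : Graph) {r : Fin (size G)} where

  solvable-here : {D : Distribution (size G)} → 1 ≤ D r → Solvable G r D
  solvable-here {D} 1≤Dr = D , ε , 1≤Dr

  solvable-after : {D : Distribution (size G)} {a b : Fin (size G)} → Adj G a b → 2 ≤ D a →
                   Solvable G r (move D a b) → Solvable G r D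
  solvable-after {D} {a} {b} a~b 2≤Da (D' , moves , 1≤D'r) =
    D' , step a b a~b D (move D a b) 2≤Da (move-balance 2≤Da) ◅ moves , 1≤D'r

  solvable-by-pebbling-root : {D : Distribution (size G)} {a : Fin (size G)} → Adj G a r → r ≢ a →
                              2 ≤ D a → Solvable G r D
  solvable-by-pebbling-root {D} a~r r≢a 2≤Da =
    solvable-after a~r 2≤Da (solvable-here (subst (1 ≤_) (sym (move-target {D = D} r≢a)) (s≤s z≤n)))

  solvable-empty-root⇒pile : {D : Distribution (size G)} → Solvable G r D → D r ≡ 0 → ∃ λ a → 2 ≤ D a
  solvable-empty-root⇒pile (_ , ε , 1≤Dr) Dr≡0 = contradiction (subst (1 ≤_) Dr≡0 1≤Dr) λ ()
  solvable-empty-root⇒pile (_ , step a _ _ _ _ 2≤Da _ ◅ _ , _) _ = a , 2≤Da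

-- Critical distributions

removeOne-same : (D : Distribution n) (v : Fin n) → removeOne D v v ≡ D v ∸ 1
removeOne-same D v with v ≟ᶠ v
... | yes _ = refl
... | no v≢v = contradiction refl v≢v

removeOne-other : (D : Distribution n) {v u : Fin n} → u ≢ v → removeOne D v u ≡ D u
removeOne-other D {v} {u} u≢v with u ≟ᶠ v
... | yes u≡v = contradiction u≡v u≢v
... | no _ = refl

removeOne-≥ᴰ : {T D : Distribution n} {v : Fin n} → T ≤ᴰ D → T v < D v → T ≤ᴰ removeOne D v
removeOne-≥ᴰ {v = v} T≤D Tv<Dv u with u ≟ᶠ v
... | yes refl = ∸-monoˡ-≤ 1 Tv<Dv
... | no _ = T≤D u

removeOne-≤ : (D : Distribution n) (v w : Fin n) → removeOne D v w ≤ D w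
removeOne-≤ D v w with w ≟ᶠ v
... | yes _ = m∸n≤m (D w) 1
... | no _ = ≤-refl

module _ (G : Graph) {r : Fin (size G)} {D : Distribution (size G)} (critical : Critical G r D) where

  critical-≤ᴰ-threshold : {T : Distribution (size G)} → (∀ E → T ≤ᴰ E → Solvable G r E) →
                          T ≤ᴰ D → D ≤ᴰ T
  critical-≤ᴰ-threshold {T} T-solves T≤D v with T v <? D v
  ... | no Dv≯Tv = ≮⇒≥ Dv≯Tv
  ... | yes Tv<Dv = contradiction (T-solves _ (removeOne-≥ᴰ T≤D Tv<Dv)) (proj₂ critical v (m<n⇒0<n Tv<Dv))

  critical-one-pile : {u : Fin (size G)} {c : ℕ} → (∀ E → c ≤ E u → Solvable G r E) → c ≤ D u →
                      total D ≤ c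
  critical-one-pile {u} {c} solves c≤Du = subst (total D ≤_) (total-pebbles u c)
    (total-mono (critical-≤ᴰ-threshold (λ E T≤E → solves E (subst (_≤ E u) (ind-≡ u c) (T≤E u)))
                                       (pebbles-≤ᴰ c≤Du)))

  critical-two-piles : {u w : Fin (size G)} {c d : ℕ} → u ≢ w →
                       (∀ E → c ≤ E u → d ≤ E w → Solvable G r E) → c ≤ D u → d ≤ D w →
                       total D ≤ c + d
  critical-two-piles {u} {w} {c} {d} u≢w solves c≤Du d≤Dw = subst (total D ≤_) total-T
    (total-mono (critical-≤ᴰ-threshold (λ E T≤E → solves E (at-u T≤E) (at-w T≤E)) T≤D))
    where
    T : Distribution (size G)
    T = addPebbles (pebbles u c) w d
    total-T : total T ≡ c + d
    total-T = trans (total-addPebbles (pebbles u c) w d) (cong (_+ d) (total-pebbles u c))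
    at-u : ∀ {E} → T ≤ᴰ E → c ≤ E u
    at-u {E} T≤E = subst (_≤ E u) (trans (cong₂ _+_ (ind-≡ u c) (ind-≢ d u≢w)) (+-identityʳ c)) (T≤E u)
    at-w : ∀ {E} → T ≤ᴰ E → d ≤ E w
    at-w {E} T≤E = subst (_≤ E w) (cong₂ _+_ (ind-≢ c (u≢w ∘ sym)) (ind-≡ w d)) (T≤E w)
    T≤D : T ≤ᴰ D
    T≤D v with v ≟ᶠ u | v ≟ᶠ w
    ... | yes refl | yes refl = contradiction refl u≢w
    ... | yes refl | no _ = subst (_≤ D v) (sym (+-identityʳ c)) c≤Du
    ... | no _ | yes refl = d≤Dw
    ... | no _ | no _ = z≤n

-- Solving distributions on the fan

module _ {k : ℕ} where

  path-≢ : {i j : Fin k} → toℕ i ≢ toℕ j → _≢_ {A = Fin (suc k)} (suc i) (suc j)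
  path-≢ i≢j = i≢j ∘ cong toℕ ∘ Fin.suc-injective

  hub≢path : (j : Fin k) → _≢_ {A = Fin (suc k)} zero (suc j)
  hub≢path j ()

  path≢hub : (j : Fin k) → _≢_ {A = Fin (suc k)} (suc j) zero
  path≢hub j ()

  solvable-hub : {E : Distribution (suc k)} {j : Fin k} → 2 ≤ E (suc j) → Solvable (Fan k) zero E
  solvable-hub {j = j} = solvable-by-pebbling-root (Fan k) (path-hub j) (hub≢path j)

  solvable-from-hub : {E : Distribution (suc k)} {i : Fin k} → 2 ≤ E zero → Solvable (Fan k) (suc i) E
  solvable-from-hub {i = i} = solvable-by-pebbling-root (Fan k) (hub-path i) (path≢hub i)

  solvable-via-hub : {E : Distribution (suc k)} {i j : Fin k} → 1 ≤ E zero → 2 ≤ E (suc j) →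
                     Solvable (Fan k) (suc i) E
  solvable-via-hub {E} {j = j} 1≤E₀ 2≤Ej = solvable-after (Fan k) (path-hub j) 2≤Ej
    (solvable-from-hub (subst (2 ≤_) (sym (move-target {D = E} (hub≢path j))) (s≤s 1≤E₀)))

  solvable-four : {E : Distribution (suc k)} {i j : Fin k} → 4 ≤ E (suc j) → Solvable (Fan k) (suc i) E
  solvable-four {E} {j = j} 4≤Ej = solvable-after (Fan k) (path-hub j) (≤-trans (s≤s (s≤s z≤n)) 4≤Ej)
    (solvable-via-hub {j = j} (subst (1 ≤_) (sym (move-target {D = E} (hub≢path j))) (s≤s z≤n))
                      (subst (2 ≤_) (sym (move-source {D = E} (path≢hub j))) (∸-monoˡ-≤ 2 4≤Ej)))

  solvable-two-piles : {E : Distribution (suc k)} {i j j' : Fin k} → suc j' ≢ suc j →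
                       2 ≤ E (suc j) → 2 ≤ E (suc j') → Solvable (Fan k) (suc i) E
  solvable-two-piles {E} {j = j} {j'} j'≢j 2≤Ej 2≤Ej' = solvable-after (Fan k) (path-hub j) 2≤Ej
    (solvable-via-hub {j = j'} (subst (1 ≤_) (sym (move-target {D = E} (hub≢path j))) (s≤s z≤n))
                      (subst (2 ≤_) (sym (move-other {D = E} j'≢j (path≢hub j'))) 2≤Ej'))

  roll-up : (d : ℕ) (i j : Fin k) {E : Distribution (suc k)} → d + suc (toℕ j) ≡ toℕ i →
            2 ≤ E (suc j) → (∀ m → toℕ j < toℕ m → toℕ m < toℕ i → 1 ≤ E (suc m)) →
            Solvable (Fan k) (suc i) E
  roll-up zero i j 1+j≡i 2≤Ej _ =
    solvable-by-pebbling-root (Fan k) (path-fwd j i 1+j≡i) (path-≢ (>⇒≢ (≤-reflexive 1+j≡i))) 2≤Ej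
  roll-up (suc d) i j {E} gap 2≤Ej filled =
    solvable-after (Fan k) (path-fwd j j' (sym j'≡1+j)) 2≤Ej (roll-up d i j' gap' 2≤E'j' filled')
    where
    1+j<i : suc (toℕ j) < toℕ i
    1+j<i = subst (suc (toℕ j) <_) gap (s≤s (m≤n+m (suc (toℕ j)) d))
    j' : Fin k
    j' = fromℕ< (<-trans 1+j<i (Fin.toℕ<n i))
    j'≡1+j : toℕ j' ≡ suc (toℕ j)
    j'≡1+j = Fin.toℕ-fromℕ< _
    j<j' : toℕ j < toℕ j'
    j<j' = ≤-reflexive (sym j'≡1+j)
    gap' : d + suc (toℕ j') ≡ toℕ i
    gap' = trans (cong (λ x → d + suc x) j'≡1+j) (trans (+-suc d (suc (toℕ j))) gap)
    2≤E'j' : 2 ≤ move E (suc j) (suc j') (suc j')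
    2≤E'j' = subst (2 ≤_) (sym (move-target {D = E} (path-≢ (>⇒≢ j<j'))))
                   (s≤s (filled j' j<j' (subst (_< toℕ i) (sym j'≡1+j) 1+j<i)))
    filled' : ∀ m → toℕ j' < toℕ m → toℕ m < toℕ i → 1 ≤ move E (suc j) (suc j') (suc m)
    filled' m j'<m m<i = ≤-trans (filled m j<m m<i) (move-≥ {D = E} (path-≢ (>⇒≢ j<m)))
      where j<m = <-trans j<j' j'<m

  roll-down : (d : ℕ) (i j : Fin k) {E : Distribution (suc k)} → d + suc (toℕ i) ≡ toℕ j →
              2 ≤ E (suc j) → (∀ m → toℕ i < toℕ m → toℕ m < toℕ j → 1 ≤ E (suc m)) →
              Solvable (Fan k) (suc i) E
  roll-down zero i j 1+i≡j 2≤Ej _ =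
    solvable-by-pebbling-root (Fan k) (path-bwd j i (sym 1+i≡j)) (path-≢ (<⇒≢ (≤-reflexive 1+i≡j))) 2≤Ej
  roll-down (suc d) i j {E} gap 2≤Ej filled =
    solvable-after (Fan k) (path-bwd j j' j≡1+j') 2≤Ej (roll-down d i j' (sym j'≡d+1+i) 2≤E'j' filled')
    where
    j' : Fin k
    j' = fromℕ< (<-trans (≤-reflexive gap) (Fin.toℕ<n j))
    j'≡d+1+i : toℕ j' ≡ d + suc (toℕ i)
    j'≡d+1+i = Fin.toℕ-fromℕ< _
    j≡1+j' : toℕ j ≡ suc (toℕ j')
    j≡1+j' = sym (trans (cong suc j'≡d+1+i) gap)
    j'<j : toℕ j' < toℕ j
    j'<j = ≤-reflexive (sym j≡1+j')
    2≤E'j' : 2 ≤ move E (suc j) (suc j') (suc j')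
    2≤E'j' = subst (2 ≤_) (sym (move-target {D = E} (path-≢ (<⇒≢ j'<j))))
                   (s≤s (filled j' (subst (toℕ i <_) (sym j'≡d+1+i) (m≤n+m (suc (toℕ i)) d)) j'<j))
    filled' : ∀ m → toℕ i < toℕ m → toℕ m < toℕ j' → 1 ≤ move E (suc j) (suc j') (suc m)
    filled' m i<m m<j' = ≤-trans (filled m i<m m<j) (move-≥ {D = E} (path-≢ (<⇒≢ m<j)))
      where m<j = <-trans m<j' j'<j

  solvable-by-rolling : {E : Distribution (suc k)} {i j : Fin k} → i ≢ j → 2 ≤ E (suc j) →
                        (∀ m → m ≢ i → m ≢ j → 1 ≤ E (suc m)) → Solvable (Fan k) (suc i) E
  solvable-by-rolling {i = i} {j} i≢j 2≤Ej filled with <-cmp (toℕ j) (toℕ i)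
  ... | tri< j<i _ _ = roll-up _ i j (m∸n+n≡m j<i) 2≤Ej
                         (λ m j<m m<i → filled m (<⇒≢ m<i ∘ cong toℕ) (>⇒≢ j<m ∘ cong toℕ))
  ... | tri≈ _ j≡i _ = contradiction (Fin.toℕ-injective (sym j≡i)) i≢j
  ... | tri> _ _ i<j = roll-down _ i j (m∸n+n≡m i<j) 2≤Ej
                         (λ m i<m m<j → filled m (>⇒≢ i<m ∘ cong toℕ) (<⇒≢ m<j ∘ cong toℕ))

-- Bounding critical distributions on the fan

module _ {k : ℕ} {D : Distribution (suc k)} {i j : Fin k} (critical : Critical (Fan k) (suc i) D) where

  pile-≤-2-without-holes : i ≢ j → (∀ m → m ≢ i → m ≢ j → D (suc m) ≢ 0) → D (suc j) ≤ 2
  pile-≤-2-without-holes i≢j no-hole with 3 ≤? D (suc j)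
  ... | no 3≰Dj = ≤-pred (≰⇒> 3≰Dj)
  ... | yes 3≤Dj = contradiction (solvable-by-rolling i≢j 2≤D'j filled)
                                 (proj₂ critical (suc j) (≤-trans (s≤s z≤n) 3≤Dj))
    where
    2≤D'j : 2 ≤ removeOne D (suc j) (suc j)
    2≤D'j = subst (2 ≤_) (sym (removeOne-same D (suc j))) (∸-monoˡ-≤ 1 3≤Dj)
    filled : ∀ m → m ≢ i → m ≢ j → 1 ≤ removeOne D (suc j) (suc m)
    filled m m≢i m≢j = subst (1 ≤_) (sym (removeOne-other D (m≢j ∘ Fin.suc-injective)))
                             (n≢0⇒n>0 (no-hole m m≢i m≢j))

  single-pile-total-≤ : D (suc i) ≡ 0 → D zero ≡ 0 → 2 ≤ D (suc j) →
                        (∀ m → m ≢ j → D (suc m) ≤ 1) → D (suc j) ≤ 3 → total D ≤ k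
  single-pile-total-≤ Di≡0 D₀≡0 2≤Dj path-≤-1 Dj≤3 =
    by-third-hole (Fin.any? (λ m → ¬? (m ≟ᶠ i) ×-dec ¬? (m ≟ᶠ j) ×-dec (D (suc m) ≟ 0)))
    where
    i≢j : i ≢ j
    i≢j refl = contradiction (subst (2 ≤_) Di≡0 2≤Dj) λ ()
    others-≤-1 : ∀ v → v ≢ suc j → D v ≤ 1
    others-≤-1 zero _ = subst (_≤ 1) (sym D₀≡0) z≤n
    others-≤-1 (suc m) m≢j = path-≤-1 m (m≢j ∘ cong suc)
    by-third-hole : Dec (∃ λ m → m ≢ i × m ≢ j × D (suc m) ≡ 0) → total D ≤ k
    by-third-hole (yes (m , m≢i , m≢j , Dm≡0)) = m+1+e≤1+n+e⇒m≤n
      (total-≤-sparse (suc j) 2 (suc i ∷ zero ∷ suc m ∷ [])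
        ((path≢hub i ∷ (m≢i ∘ sym ∘ Fin.suc-injective) ∷ []) ∷ (hub≢path m ∷ []) ∷ [] ∷ [])
        ((i≢j ∘ Fin.suc-injective , Di≡0) ∷ (hub≢path j , D₀≡0) ∷
         (m≢j ∘ Fin.suc-injective , Dm≡0) ∷ [])
        others-≤-1 Dj≤3)
    by-third-hole (no no-third-hole) = m+1+e≤1+n+e⇒m≤n
      (total-≤-sparse (suc j) 1 (suc i ∷ zero ∷ [])
        ((path≢hub i ∷ []) ∷ [] ∷ [])
        ((i≢j ∘ Fin.suc-injective , Di≡0) ∷ (hub≢path j , D₀≡0) ∷ [])
        others-≤-1 (pile-≤-2-without-holes i≢j λ m m≢i m≢j Dm≡0 →
                      no-third-hole (m , m≢i , m≢j , Dm≡0)))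

  hub-empty-total-≤ : 4 ≤ k → D (suc i) ≡ 0 → D zero ≡ 0 → 2 ≤ D (suc j) → total D ≤ k
  hub-empty-total-≤ 4≤k Di≡0 D₀≡0 2≤Dj
    with 4 ≤? D (suc j) | Fin.any? (λ m → ¬? (m ≟ᶠ j) ×-dec (2 ≤? D (suc m)))
  ... | yes 4≤Dj | _ = ≤-trans (critical-one-pile (Fan k) critical (λ E → solvable-four) 4≤Dj) 4≤k
  ... | no _ | yes (j' , j'≢j , 2≤Dj') =
        ≤-trans (critical-two-piles (Fan k) critical (j'≢j ∘ Fin.suc-injective ∘ sym)
                  (λ E → solvable-two-piles (j'≢j ∘ Fin.suc-injective)) 2≤Dj 2≤Dj') 4≤k
  ... | no 4≰Dj | no no-second-pile = single-pile-total-≤ Di≡0 D₀≡0 2≤Dj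
        (λ m m≢j → ≤-pred (≰⇒> λ 2≤Dm → no-second-pile (m , m≢j , 2≤Dm)))
        (≤-pred (≰⇒> 4≰Dj))

module _ {k : ℕ} (4≤k : 4 ≤ k) {D : Distribution (suc k)} where

  private
    3≤k : 3 ≤ k
    3≤k = ≤-trans (n≤1+n 3) 4≤k

    2≤k : 2 ≤ k
    2≤k = ≤-trans (n≤1+n 2) 3≤k

  critical-with-pile-total-≤ : (r a : Fin (suc k)) → Critical (Fan k) r D → D r ≡ 0 → 2 ≤ D a →
                               total D ≤ k
  critical-with-pile-total-≤ zero zero _ D₀≡0 2≤D₀ = contradiction (subst (2 ≤_) D₀≡0 2≤D₀) λ ()
  critical-with-pile-total-≤ zero (suc j) critical _ 2≤Dj =
    ≤-trans (critical-one-pile (Fan k) critical (λ E → solvable-hub) 2≤Dj) 2≤k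
  critical-with-pile-total-≤ (suc i) zero critical _ 2≤D₀ =
    ≤-trans (critical-one-pile (Fan k) critical (λ E → solvable-from-hub) 2≤D₀) 2≤k
  critical-with-pile-total-≤ (suc i) (suc j) critical Di≡0 2≤Dj with D zero ≟ 0
  ... | yes D₀≡0 = hub-empty-total-≤ critical 4≤k Di≡0 D₀≡0 2≤Dj
  ... | no D₀≢0 = ≤-trans (critical-two-piles (Fan k) critical (hub≢path j) (λ E → solvable-via-hub)
                                              (n≢0⇒n>0 D₀≢0) 2≤Dj) 3≤k

  fan-critical-total-≤ : (r : Fin (suc k)) → Critical (Fan k) r D → total D ≤ k
  fan-critical-total-≤ r critical with D r ≟ 0
  ... | yes Dr≡0 = let a , 2≤Da = solvable-empty-root⇒pile (Fan k) (proj₁ critical) Dr≡0 in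
                   critical-with-pile-total-≤ r a critical Dr≡0 2≤Da
  ... | no Dr≢0 = ≤-trans (critical-one-pile (Fan k) critical (λ E → solvable-here (Fan k)) (n≢0⇒n>0 Dr≢0))
                          (≤-trans (n≤1+n 1) 2≤k)

-- Hopeless distributions

module _ {k₁ : ℕ} where
  private
    k : ℕ
    k = suc k₁

  root : Fin (suc k)
  root = suc zero

  record Blocked (D : Distribution (suc k)) : Set where
    field
      gap pile     : Fin k
      0<gap        : 0 < toℕ gap
      gap<pile     : toℕ gap < toℕ pile
      hub-empty    : D zero ≡ 0
      gap-empty    : D (suc gap) ≡ 0
      pile-two     : D (suc pile) ≡ 2
      others-≤-1   : ∀ v → v ≢ suc pile → D v ≤ 1

  Hopeless : Distribution (suc k) → Set
  Hopeless D = D root ≡ 0 × (Stuck D ⊎ Blocked D)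

  hopeless-resp : {D E : Distribution (suc k)} → (∀ v → D v ≡ E v) → Hopeless D → Hopeless E
  hopeless-resp D≗E (root-empty , inj₁ stuck) =
    trans (sym (D≗E root)) root-empty , inj₁ (λ v → subst (_≤ 1) (D≗E v) (stuck v))
  hopeless-resp D≗E (root-empty , inj₂ blocked) = trans (sym (D≗E root)) root-empty , inj₂ (record
    { gap        = gap
    ; pile       = pile
    ; 0<gap      = 0<gap
    ; gap<pile   = gap<pile
    ; hub-empty  = trans (sym (D≗E zero)) hub-empty
    ; gap-empty  = trans (sym (D≗E (suc gap))) gap-empty
    ; pile-two   = trans (sym (D≗E (suc pile))) pile-two
    ; others-≤-1 = λ v v≢pile → subst (_≤ 1) (D≗E v) (others-≤-1 v v≢pile)
    })
    where open Blocked blocked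

  module _ {D : Distribution (suc k)} (root-empty : D root ≡ 0) (blocked : Blocked D) where
    open Blocked blocked

    private
      pile≢gap : pile ≢ gap
      pile≢gap pile≡gap = <⇒≢ gap<pile (cong toℕ (sym pile≡gap))

      root≢path : {u : Fin k} → toℕ gap ≤ toℕ u → root ≢ suc u
      root≢path {zero} gap≤u refl = contradiction (≤-trans 0<gap gap≤u) λ ()

      pile-≤-3 : D (suc pile) ≤ 3
      pile-≤-3 = subst (_≤ 3) (sym pile-two) (n≤1+n 2)

      root-stays-empty : {b : Fin (suc k)} → root ≢ b → move D (suc pile) b root ≡ 0
      root-stays-empty root≢b = trans (move-other {D = D} (root≢path (<⇒≤ gap<pile)) root≢b) root-empty

    hopeless-after-move-to-path : (u : Fin k) → toℕ gap ≤ toℕ u → u ≢ pile →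
                                  Hopeless (move D (suc pile) (suc u))
    hopeless-after-move-to-path u gap≤u u≢pile =
      root-stays-empty (root≢path gap≤u) , by-target (D (suc u)) refl (others-≤-1 (suc u) (pile≢u ∘ sym))
      where
      pile≢u : _≢_ {A = Fin (suc k)} (suc pile) (suc u)
      pile≢u = u≢pile ∘ sym ∘ Fin.suc-injective
      by-target : (x : ℕ) → D (suc u) ≡ x → x ≤ 1 →
                  Stuck (move D (suc pile) (suc u)) ⊎ Blocked (move D (suc pile) (suc u))
      by-target zero Du≡0 _ = inj₁ (stuck-after-move-to-empty pile≢u pile-≤-3 others-≤-1 Du≡0)
      by-target (suc zero) Du≡1 _ = inj₂ (record
        { gap        = gap
        ; pile       = u
        ; 0<gap      = 0<gap
        ; gap<pile   = ≤∧≢⇒< gap≤u (gap≢u ∘ Fin.toℕ-injective)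
        ; hub-empty  = trans (move-other {D = D} (hub≢path pile) (hub≢path u)) hub-empty
        ; gap-empty  = trans (move-other {D = D} (pile≢gap ∘ sym ∘ Fin.suc-injective)
                                                 (gap≢u ∘ Fin.suc-injective))
                             gap-empty
        ; pile-two   = trans (move-target {D = D} (pile≢u ∘ sym)) (cong suc Du≡1)
        ; others-≤-1 = move-≤-1-off-target pile≢u pile-≤-3 others-≤-1
        })
        where
        gap≢u : gap ≢ u
        gap≢u refl = contradiction (trans (sym gap-empty) Du≡1) λ ()
      by-target (suc (suc _)) _ (s≤s ())

    hopeless-after-step : {b : Fin (suc k)} → FanAdj k (suc pile) b → Hopeless (move D (suc pile) b)
    hopeless-after-step (path-hub _) =
      root-stays-empty (path≢hub zero) ,
      inj₁ (stuck-after-move-to-empty (path≢hub pile) pile-≤-3 others-≤-1 hub-empty)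
    hopeless-after-step (path-fwd _ u 1+pile≡u) =
      hopeless-after-move-to-path u (≤-trans (<⇒≤ gap<pile) (subst (toℕ pile ≤_) 1+pile≡u (n≤1+n _)))
        (<⇒≢ (≤-reflexive 1+pile≡u) ∘ sym ∘ cong toℕ)
    hopeless-after-step (path-bwd _ u pile≡1+u) =
      hopeless-after-move-to-path u (≤-pred (subst (toℕ gap <_) pile≡1+u gap<pile))
        (<⇒≢ (≤-reflexive (sym pile≡1+u)) ∘ cong toℕ)

  hopeless-step : {D D' : Distribution (suc k)} → Step (Fan k) D D' → Hopeless D → Hopeless D'
  hopeless-step (step a _ _ _ _ 2≤Da _) (_ , inj₁ stuck) =
    contradiction (≤-trans 2≤Da (stuck a)) λ { (s≤s ()) }
  hopeless-step (step a b a~b D D' 2≤Da balance) (root-empty , inj₂ blocked)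
    with a ≟ᶠ suc (Blocked.pile blocked)
  ... | yes refl = hopeless-resp (sym ∘ step-moves balance 2≤Da) (hopeless-after-step root-empty blocked a~b)
  ... | no a≢pile = contradiction (≤-trans 2≤Da (Blocked.others-≤-1 blocked a a≢pile)) λ { (s≤s ()) }

  hopeless-unsolvable : {D : Distribution (suc k)} → Hopeless D → ¬ Solvable (Fan k) root D
  hopeless-unsolvable (root-empty , _) (_ , ε , 1≤Dr) = contradiction (subst (1 ≤_) root-empty 1≤Dr) λ ()
  hopeless-unsolvable hopeless (D' , s ◅ steps , 1≤D'r) =
    hopeless-unsolvable (hopeless-step s hopeless) (D' , steps , 1≤D'r)

-- The extremal distribution

module _ (k₂ : ℕ) where
  private
    k : ℕ
    k = suc (suc k₂)

    last : Fin (suc k₂)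
    last = fromℕ k₂

  extremal : Distribution (suc k)
  extremal zero = 0
  extremal (suc zero) = 0
  extremal (suc (suc m)) = suc (ind m last 1)

  private
    extremal-last : extremal (suc (suc last)) ≡ 2
    extremal-last = cong suc (ind-≡ last 1)

    extremal-≤-1 : ∀ v → v ≢ suc (suc last) → extremal v ≤ 1
    extremal-≤-1 zero _ = z≤n
    extremal-≤-1 (suc zero) _ = z≤n
    extremal-≤-1 (suc (suc m)) m≢last = s≤s (≤-reflexive (ind-≢ 1 λ { refl → m≢last refl }))

    root-empty-after-removal : ∀ v → removeOne extremal v root ≡ 0
    root-empty-after-removal v with root ≟ᶠ v
    ... | yes _ = refl
    ... | no _ = refl

  total-extremal : total extremal ≡ k
  total-extremal = begin
    total extremal                       ≡⟨ total-suc {k} extremal ⟩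
    total (extremal ∘ suc)               ≡⟨ total-suc {suc k₂} (extremal ∘ suc) ⟩
    total (addPebbles (λ _ → 1) last 1)  ≡⟨ total-addPebbles (λ _ → 1) last 1 ⟩
    total {suc k₂} (λ _ → 1) + 1         ≡⟨ cong (_+ 1) (total-const {suc k₂} 1) ⟩
    suc k₂ * 1 + 1                       ≡⟨ cong (_+ 1) (*-identityʳ (suc k₂)) ⟩
    suc k₂ + 1                           ≡⟨ +-comm (suc k₂) 1 ⟩
    k                                    ∎
    where open ≡-Reasoning

  extremal-solvable : Solvable (Fan k) root extremal
  extremal-solvable = roll-down k₂ zero (suc last) (trans (+-comm k₂ 1) (cong suc (sym (Fin.toℕ-fromℕ k₂))))
    (≤-reflexive (sym extremal-last)) filled
    where
    filled : ∀ m → 0 < toℕ m → toℕ m < toℕ (suc last) → 1 ≤ extremal (suc m)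
    filled (suc m) _ _ = s≤s z≤n

  extremal-minimal : ∀ v → 1 ≤ extremal v → ¬ Solvable (Fan k) root (removeOne extremal v)
  extremal-minimal (suc (suc m)) _ with m ≟ᶠ last
  ... | yes refl = hopeless-unsolvable (root-empty-after-removal (suc (suc last)) , inj₁ stuck)
    where
    stuck : Stuck (removeOne extremal (suc (suc last)))
    stuck w with w ≟ᶠ suc (suc last)
    ... | yes refl = ≤-reflexive (cong (_∸ 1) extremal-last)
    ... | no w≢last = extremal-≤-1 w w≢last
  ... | no m≢last = hopeless-unsolvable (root-empty-after-removal (suc (suc m)) , inj₂ (record
    { gap        = suc m
    ; pile       = suc last
    ; 0<gap      = s≤s z≤n
    ; gap<pile   = s≤s (Fin.≤∧≢⇒< (Fin.≤fromℕ m) m≢last)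
    ; hub-empty  = refl
    ; gap-empty  = trans (removeOne-same extremal (suc (suc m))) (ind-≢ 1 m≢last)
    ; pile-two   = trans (removeOne-other extremal (m≢last ∘ sym ∘ Fin.suc-injective ∘ Fin.suc-injective))
                         extremal-last
    ; others-≤-1 = λ w w≢last → ≤-trans (removeOne-≤ extremal _ w) (extremal-≤-1 w w≢last)
    }))

theorem8 : (k : ℕ) → 4 ≤ k → IsCriticalPebblingNumber (Fan k) k
theorem8 zero ()
theorem8 (suc zero) (s≤s ())
theorem8 (suc (suc k₂)) 4≤k =
  (root , extremal k₂ , (extremal-solvable k₂ , extremal-minimal k₂) , total-extremal k₂) ,
  λ r D → fan-critical-total-≤ 4≤k r
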